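{- Let $V$ be a finite set and let $A$ be a $V\times V$-matrix over $\mathrm{GF}(4)$ that is $\mathrm{inv}$-symmetric, i.e. $\mathrm{inv}(-A^T)=A$ (equivalently $\mathrm{inv}(A^T)=A$, as $-1=1$ in $\mathrm{GF}(4)$). Then $A$ is principally unimodular: for every $Y\subseteq V$, $\det(A[Y])\in\{0,1,-1\}$.
   Context: $\mathrm{inv}$ denotes the unique nontrivial field automorphism of $\mathrm{GF}(4)$, namely $x\mapsto x^2$ (so $\mathrm{inv}(x)=x^{ -1}$ for $x\neq 0$); it is applied entrywise to matrices. Rows and columns of a $V\times V$-matrix are indexed by $V$ (unordered); $A[Y]$ denotes the principal submatrix with rows and columns indexed by $Y$, and $\det(A[\emptyset])=1$ by convention. -}

module Defs where

open import Data.Nat using (ℕ; zero; suc)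
open import Data.Fin using (Fin; zero; suc; punchIn)
open import Data.Fin.Subset using (Subset; inside; outside)
open import Data.Vec using (Vec; []; _∷_)
open import Data.List using (List; []; _∷_; length; map)
open import Data.List.Base using (lookup)
open import Relation.Binary.PropositionalEquality using (_≡_)

-- The field GF(4) = {0, 1, ω, ω²} with ω² = ω + 1.
data GF4 : Set where
  𝟘 𝟙 ω ω² : GF4

infixl 6 _+_
infixl 7 _*_

_+_ : GF4 → GF4 → GF4
𝟘  + y  = y
x  + 𝟘  = x
𝟙  + 𝟙  = 𝟘
𝟙  + ω  = ω²
𝟙  + ω² = ω
ω  + 𝟙  = ω²
ω  + ω  = 𝟘
ω  + ω² = 𝟙
ω² + 𝟙  = ω
ω² + ω  = 𝟙
ω² + ω² = 𝟘

_*_ : GF4 → GF4 → GF4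
𝟘  * y  = 𝟘
x  * 𝟘  = 𝟘
𝟙  * y  = y
x  * 𝟙  = x
ω  * ω  = ω²
ω  * ω² = 𝟙
ω² * ω  = 𝟙
ω² * ω² = ω

-- additive inverse (characteristic 2: every element is its own negative)
-_ : GF4 → GF4
- x = x

-- the nontrivial field automorphism x ↦ x²
inv : GF4 → GF4
inv 𝟘  = 𝟘
inv 𝟙  = 𝟙
inv ω  = ω²
inv ω² = ω

-- square matrices over GF(4) indexed by a finite set V = Fin n
Matrix : ℕ → Set
Matrix n = Fin n → Fin n → GF4

InvSymmetric : ∀ {n} → Matrix n → Set
InvSymmetric {n} A = (i j : Fin n) → inv (- A j i) ≡ A i j

Σ : ∀ k → (Fin k → GF4) → GF4
Σ zero    f = 𝟘
Σ (suc k) f = f zero + Σ k (λ j → f (suc j))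

sgn : ∀ {k} → Fin k → GF4 → GF4
sgn zero    x = x
sgn (suc j) x = - sgn j x

det : ∀ k → Matrix k → GF4
det zero    M = 𝟙
det (suc k) M =
  Σ (suc k) (λ j → sgn j (M zero j * det k (λ r c → M (suc r) (punchIn j c))))

elements : ∀ {n} → Subset n → List (Fin n)
elements []            = []
elements (inside  ∷ p) = zero ∷ map suc (elements p)
elements (outside ∷ p) = map suc (elements p)

-- principal submatrix A[Y] (rows/columns listed in increasing order;
-- the determinant does not depend on this ordering)
principal : ∀ {n} → Matrix n → (Y : Subset n) → Matrix (length (elements Y))
principal A Y r c = A (lookup (elements Y) r) (lookup (elements Y) c)

detSub : ∀ {n} → Matrix n → Subset n → GF4
detSub A Y = det (length (elements Y)) (principal A Y)

module Submission where

-- Over GF(4) the automorphism inv commutes with the determinant, and the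
-- determinant is invariant under transposition.  Hence for an inv-symmetric
-- matrix M (inv (M j i) = M i j, i.e. M equals its conjugate transpose)
--   inv (det M) = det (inv M) = det (Mᵀ) = det M,
-- so det M lies in the fixed field {𝟘, 𝟙} = GF(2) of inv.  Every principal
-- submatrix of an inv-symmetric matrix is again inv-symmetric, which gives
-- principal unimodularity.

open import Relation.Binary.PropositionalEquality using (_≡_; refl; sym; trans; cong; cong₂; module ≡-Reasoning)
open import Algebra.Bundles using (CommutativeSemiring)
open import Data.Fin using (Fin; zero; suc; punchIn)
open import Data.Fin.Subset using (Subset)
open import Data.Nat using (ℕ; zero; suc)
import Data.Nat as ℕ
open import Data.Product using (_,_)
open import Data.Sum using (_⊎_; inj₁; inj₂)
open import Data.Vec.Functional using (Vector)
open import Level using (0ℓ)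
open import Relation.Binary.Definitions using (DecidableEquality)
open import Relation.Binary.PropositionalEquality.Algebra using (isMagma)
open import Relation.Nullary.Decidable using (Dec; map′; _×-dec_; from-yes)

-- In any commutative semiring, the two ways of evaluating the weighted double
-- sum  Σ_j Σ_i a_j b_i X_ij  agree; this is the heart of the column expansion.
module WeightedSums {c ℓ} (R : CommutativeSemiring c ℓ) where
  open CommutativeSemiring R
  open import Algebra.Properties.Semiring.Sum semiring
  open import Algebra.Properties.CommutativeSemigroup *-commutativeSemigroup
    using (x∙yz≈y∙xz)
  open import Relation.Binary.Reasoning.Setoid setoid

  ∑-exchange : ∀ {m n} (a : Vector Carrier n) (b : Vector Carrier m)
    (X : Fin m → Fin n → Carrier) →
    ∑[ j < n ] (a j * ∑[ i < m ] (b i * X i j)) ≈ ∑[ i < m ] (b i * ∑[ j < n ] (a j * X i j))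
  ∑-exchange {m} {n} a b X = begin
    ∑[ j < n ] (a j * ∑[ i < m ] (b i * X i j))   ≈⟨ sum-cong-≋ (λ j → *-distribˡ-sum (a j) (λ i → b i * X i j)) ⟩
    ∑[ j < n ] ∑[ i < m ] (a j * (b i * X i j))   ≈⟨ ∑-comm (λ j i → a j * (b i * X i j)) ⟩
    ∑[ i < m ] ∑[ j < n ] (a j * (b i * X i j))   ≈⟨ sum-cong-≋ (λ i → sum-cong-≋ (λ j → x∙yz≈y∙xz (a j) (b i) (X i j))) ⟩
    ∑[ i < m ] ∑[ j < n ] (b i * (a j * X i j))   ≈⟨ sum-cong-≋ (λ i → *-distribˡ-sum (b i) (λ j → a j * X i j)) ⟨
    ∑[ i < m ] (b i * ∑[ j < n ] (a j * X i j))   ∎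

open import Defs
open import Algebra.Definitions {A = GF4} _≡_ using (Associative; Commutative; LeftIdentity; LeftZero; _DistributesOverʳ_)
open import Algebra.Structures {A = GF4} _≡_ using (IsCommutativeMonoid)
open import Algebra.Structures.Biased {A = GF4} _≡_ using (isCommutativeMonoidˡ; isCommutativeSemiringˡ)

index : GF4 → ℕ
index 𝟘  = 0
index 𝟙  = 1
index ω  = 2
index ω² = 3

fromIndex : ℕ → GF4
fromIndex 0 = 𝟘
fromIndex 1 = 𝟙
fromIndex 2 = ω
fromIndex _ = ω²

fromIndex-index : ∀ x → fromIndex (index x) ≡ x
fromIndex-index 𝟘  = refl
fromIndex-index 𝟙  = refl
fromIndex-index ω  = refl
fromIndex-index ω² = refl

index-injective : ∀ x y → index x ≡ index y → x ≡ y
index-injective x y e =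
  trans (sym (fromIndex-index x)) (trans (cong fromIndex e) (fromIndex-index y))

infix 4 _≟_
_≟_ : DecidableEquality GF4
x ≟ y = map′ (index-injective x y) (cong index) (index x ℕ.≟ index y)

-- Combined with 'from-yes' this proves identities by exhaustive evaluation.
every : {P : GF4 → Set} → P 𝟘 → P 𝟙 → P ω → P ω² → ∀ x → P x
every p₀ p₁ p₂ p₃ 𝟘  = p₀
every p₀ p₁ p₂ p₃ 𝟙  = p₁
every p₀ p₁ p₂ p₃ ω  = p₂
every p₀ p₁ p₂ p₃ ω² = p₃

∀? : {P : GF4 → Set} → (∀ x → Dec (P x)) → Dec (∀ x → P x)
∀? P? = map′ (λ (p₀ , p₁ , p₂ , p₃) → every p₀ p₁ p₂ p₃)
             (λ p → p 𝟘 , p 𝟙 , p ω , p ω²)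
             (P? 𝟘 ×-dec P? 𝟙 ×-dec P? ω ×-dec P? ω²)

+-assoc : Associative _+_
+-assoc = from-yes (∀? λ x → ∀? λ y → ∀? λ z → x + y + z ≟ x + (y + z))

+-comm : Commutative _+_
+-comm = from-yes (∀? λ x → ∀? λ y → x + y ≟ y + x)

+-identityˡ : LeftIdentity 𝟘 _+_
+-identityˡ _ = refl

*-assoc : Associative _*_
*-assoc = from-yes (∀? λ x → ∀? λ y → ∀? λ z → x * y * z ≟ x * (y * z))

*-comm : Commutative _*_
*-comm = from-yes (∀? λ x → ∀? λ y → x * y ≟ y * x)

*-identityˡ : LeftIdentity 𝟙 _*_
*-identityˡ = from-yes (∀? λ x → 𝟙 * x ≟ x)

*-distribʳ-+ : _*_ DistributesOverʳ _+_
*-distribʳ-+ = from-yes (∀? λ x → ∀? λ y → ∀? λ z → (y + z) * x ≟ y * x + z * x)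

*-zeroˡ : LeftZero 𝟘 _*_
*-zeroˡ _ = refl

inv-+ : ∀ x y → inv (x + y) ≡ inv x + inv y
inv-+ = from-yes (∀? λ x → ∀? λ y → inv (x + y) ≟ inv x + inv y)

inv-* : ∀ x y → inv (x * y) ≡ inv x * inv y
inv-* = from-yes (∀? λ x → ∀? λ y → inv (x * y) ≟ inv x * inv y)

inv-fixed : ∀ x → inv x ≡ x → x ≡ 𝟘 ⊎ x ≡ 𝟙 ⊎ x ≡ - 𝟙
inv-fixed 𝟘  _ = inj₁ refl
inv-fixed 𝟙  _ = inj₂ (inj₁ refl)
inv-fixed ω  ()
inv-fixed ω² ()

commutativeMonoid : ∀ (_∙_ : GF4 → GF4 → GF4) ε →
  Associative _∙_ → LeftIdentity ε _∙_ → Commutative _∙_ → IsCommutativeMonoid _∙_ ε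
commutativeMonoid _∙_ ε assoc identityˡ comm = isCommutativeMonoidˡ record
  { isSemigroup = record { isMagma = isMagma _∙_ ; assoc = assoc }
  ; identityˡ   = identityˡ
  ; comm        = comm
  }

GF4-commutativeSemiring : CommutativeSemiring 0ℓ 0ℓ
GF4-commutativeSemiring = record
  { isCommutativeSemiring = isCommutativeSemiringˡ record
    { +-isCommutativeMonoid = commutativeMonoid _+_ 𝟘 +-assoc +-identityˡ +-comm
    ; *-isCommutativeMonoid = commutativeMonoid _*_ 𝟙 *-assoc *-identityˡ *-comm
    ; distribʳ              = *-distribʳ-+
    ; zeroˡ                 = *-zeroˡ
    }
  }

open CommutativeSemiring GF4-commutativeSemiring using (semiring)
open import Algebra.Properties.Semiring.Sum semiring using (sum; sum-syntax; sum-cong-≗)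
open WeightedSums GF4-commutativeSemiring using (∑-exchange)
open ≡-Reasoning

Σ≡sum : ∀ k (f : Fin k → GF4) → Σ k f ≡ sum f
Σ≡sum zero    f = refl
Σ≡sum (suc k) f = cong (f zero +_) (Σ≡sum k (λ j → f (suc j)))

inv-sum : ∀ k (f : Fin k → GF4) → inv (sum f) ≡ sum (λ i → inv (f i))
inv-sum zero    f = refl
inv-sum (suc k) f = trans (inv-+ (f zero) _) (cong (inv (f zero) +_) (inv-sum k (λ i → f (suc i))))

sgn-trivial : ∀ {k} (j : Fin k) x → sgn j x ≡ x
sgn-trivial zero    x = refl
sgn-trivial (suc j) x = sgn-trivial j x

-- Mᵀ and the entrywise conjugate inv M; M is inv-symmetric iff conj M = Mᵀ.
transpose : ∀ {k} → Matrix k → Matrix k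
transpose M i j = M j i

conj : ∀ {k} → Matrix k → Matrix k
conj M i j = inv (M i j)

minor : ∀ {k} → Matrix (suc k) → Fin (suc k) → Fin (suc k) → Matrix k
minor M i j r c = M (punchIn i r) (punchIn j c)

laplace-row : ∀ k (M : Matrix (suc k)) →
  det (suc k) M ≡ ∑[ j < suc k ] (M zero j * det k (minor M zero j))
laplace-row k M = begin
  det (suc k) M                ≡⟨ Σ≡sum (suc k) signedTerm ⟩
  ∑[ j < suc k ] signedTerm j  ≡⟨ sum-cong-≗ (λ j → sgn-trivial j (term j)) ⟩
  ∑[ j < suc k ] term j        ∎
  where
  term signedTerm : Fin (suc k) → GF4
  term j = M zero j * det k (minor M zero j)
  signedTerm j = sgn j (term j)

-- By induction: expand along the
-- first row, expand each minor M₀ⱼ (j ≠ 0) along its first column, exchange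
-- the resulting double sum, and recognise row expansions of the minors Mᵢ₀.
laplace-col : ∀ k (M : Matrix (suc k)) →
  det (suc k) M ≡ ∑[ i < suc k ] (M i zero * det k (minor M i zero))
laplace-col zero    M = laplace-row zero M
laplace-col (suc k) M =
  trans (laplace-row (suc k) M) (cong (M zero zero * det (suc k) (minor M zero zero) +_) off-diagonal)
  where
  off-diagonal :
    ∑[ j < suc k ] (M zero (suc j) * det (suc k) (minor M zero (suc j))) ≡
    ∑[ i < suc k ] (M (suc i) zero * det (suc k) (minor M (suc i) zero))
  off-diagonal = begin
    ∑[ j < suc k ] (M zero (suc j) * det (suc k) (minor M zero (suc j)))
      ≡⟨ sum-cong-≗ (λ j → cong (M zero (suc j) *_) (laplace-col k (minor M zero (suc j)))) ⟩
    ∑[ j < suc k ] (M zero (suc j) * ∑[ i < suc k ] (M (suc i) zero * det k (minor (minor M zero (suc j)) i zero)))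
      ≡⟨ ∑-exchange (λ j → M zero (suc j)) (λ i → M (suc i) zero) (λ i j → det k (minor (minor M zero (suc j)) i zero)) ⟩
    ∑[ i < suc k ] (M (suc i) zero * ∑[ j < suc k ] (M zero (suc j) * det k (minor (minor M (suc i) zero) zero j)))
      ≡⟨ sum-cong-≗ (λ i → cong (M (suc i) zero *_) (sym (laplace-row k (minor M (suc i) zero)))) ⟩
    ∑[ i < suc k ] (M (suc i) zero * det (suc k) (minor M (suc i) zero))
      ∎

det-cong : ∀ k {M N : Matrix k} → (∀ i j → M i j ≡ N i j) → det k M ≡ det k N
det-cong zero    M≡N = refl
det-cong (suc k) {M} {N} M≡N = begin
  det (suc k) M
    ≡⟨ laplace-row k M ⟩
  ∑[ j < suc k ] (M zero j * det k (minor M zero j))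
    ≡⟨ sum-cong-≗ (λ j → cong₂ _*_ (M≡N zero j) (det-cong k (λ r c → M≡N (suc r) (punchIn j c)))) ⟩
  ∑[ j < suc k ] (N zero j * det k (minor N zero j))
    ≡⟨ laplace-row k N ⟨
  det (suc k) N
    ∎

-- det Mᵀ = det M: row expansion of Mᵀ is column expansion of M.
det-transpose : ∀ k (M : Matrix k) → det k (transpose M) ≡ det k M
det-transpose zero    M = refl
det-transpose (suc k) M = begin
  det (suc k) (transpose M)                          ≡⟨ laplace-row k (transpose M) ⟩
  ∑[ j < suc k ] (M j zero * det k (transpose (minor M j zero)))
    ≡⟨ sum-cong-≗ (λ j → cong (M j zero *_) (det-transpose k (minor M j zero))) ⟩
  ∑[ j < suc k ] (M j zero * det k (minor M j zero)) ≡⟨ laplace-col k M ⟨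
  det (suc k) M                                      ∎

det-conj : ∀ k (M : Matrix k) → det k (conj M) ≡ inv (det k M)
det-conj zero    M = refl
det-conj (suc k) M = begin
  det (suc k) (conj M)                                           ≡⟨ laplace-row k (conj M) ⟩
  ∑[ j < suc k ] (inv (M zero j) * det k (conj (minor M zero j)))
    ≡⟨ sum-cong-≗ (λ j → cong (inv (M zero j) *_) (det-conj k (minor M zero j))) ⟩
  ∑[ j < suc k ] (inv (M zero j) * inv (det k (minor M zero j)))
    ≡⟨ sum-cong-≗ (λ j → inv-* (M zero j) (det k (minor M zero j))) ⟨
  ∑[ j < suc k ] inv (M zero j * det k (minor M zero j))         ≡⟨ inv-sum (suc k) (λ j → M zero j * det k (minor M zero j)) ⟨
  inv (∑[ j < suc k ] (M zero j * det k (minor M zero j)))       ≡⟨ cong inv (laplace-row k M) ⟨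
  inv (det (suc k) M)                                            ∎

det-invSymmetric : ∀ k (M : Matrix k) → InvSymmetric M → inv (det k M) ≡ det k M
det-invSymmetric k M symmetric = begin
  inv (det k M)           ≡⟨ det-conj k M ⟨
  det k (conj M)          ≡⟨ det-cong k (λ i j → symmetric j i) ⟩
  det k (transpose M)     ≡⟨ det-transpose k M ⟩
  det k M                 ∎

principal-invSymmetric : ∀ {n} (A : Matrix n) → InvSymmetric A →
  (Y : Subset n) → InvSymmetric (principal A Y)
principal-invSymmetric A symmetric Y i j = symmetric _ _

theorem1 : (n : ℕ) (A : Matrix n) → InvSymmetric A →
    (Y : Subset n) → detSub A Y ≡ 𝟘 ⊎ detSub A Y ≡ 𝟙 ⊎ detSub A Y ≡ - 𝟙
theorem1 n A symmetric Y =
  inv-fixed (detSub A Y)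
    (det-invSymmetric _ (principal A Y) (principal-invSymmetric A symmetric Y))
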